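{- Let $(\mathcal{S}_n)_{n\ge1}$ be the Sierpiński gasket graphs. For every $n\geq 2$, the number of maximum independent sets (independent sets of largest cardinality) of $\mathcal{S}_n$ equals $2^{\frac{3^{n-2}-1}{2}}$.
   Context: The Sierpiński gasket graphs $\mathcal{S}_n$, each with three distinguished "outmost" vertices $A_n,B_n,C_n$, are defined recursively: $\mathcal{S}_1$ is a triangle with vertices $A_1,B_1,C_1$. Given $\mathcal{S}_n$, take three disjoint copies $\mathcal{S}_n^{(1)},\mathcal{S}_n^{(2)},\mathcal{S}_n^{(3)}$ with outmost vertices $A_n^{(\theta)},B_n^{(\theta)},C_n^{(\theta)}$; identify $B_n^{(1)}$ with $A_n^{(2)}$, $C_n^{(1)}$ with $A_n^{(3)}$, and $C_n^{(2)}$ with $B_n^{(3)}$; the result is $\mathcal{S}_{n+1}$, with outmost vertices $A_{n+1}=A_n^{(1)}$, $B_{n+1}=B_n^{(2)}$, $C_{n+1}=C_n^{(3)}$. An independent set is a set of pairwise non-adjacent vertices. -}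

module Defs where

open import Data.Nat using (ℕ; zero; suc; _+_; _*_; _≤_)
open import Data.Fin using (Fin; join; combine)
open import Data.Fin.Subset using (Subset; _∈_; ∣_∣)
open import Data.Empty using (⊥)
open import Data.Sum using (_⊎_; inj₁; inj₂)
open import Data.Product using (_×_; _,_; ∃)
open import Data.List using (List; length)
open import Data.List.Relation.Unary.Unique.Propositional using (Unique)
open import Data.List.Membership.Propositional renaming (_∈_ to _∈ₗ_)
open import Relation.Nullary using (¬_)
open import Relation.Binary.PropositionalEquality using (_≡_; _≢_)
open import Function.Bundles using (_⇔_)

-- Convention: everything indexed by a level k ∈ ℕ describes the
-- Sierpiński gasket graph 𝒮_{k+1}  (level 0 = the triangle 𝒮_1).

-- The three outmost vertices A, B, C; also used to name the three copies
-- 𝒮^{(1)}, 𝒮^{(2)}, 𝒮^{(3)} (copy 1 ↔ A, copy 2 ↔ B, copy 3 ↔ C).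
data Corner : Set where
  A B C : Corner

-- The three identified vertices created in the gluing step:
-- jAB = B^{(1)} = A^{(2)},  jAC = C^{(1)} = A^{(3)},  jBC = C^{(2)} = B^{(3)}.
data Junction : Set where
  jAB jAC jBC : Junction

Inner : ℕ → Set
Inner zero    = ⊥
Inner (suc k) = Junction ⊎ (Corner × Inner k)

data Vertex (k : ℕ) : Set where
  out : Corner → Vertex k
  inn : Inner k → Vertex k

cornerImage : ∀ {k} → Corner → Corner → Vertex (suc k)
cornerImage A A = out A
cornerImage A B = inn (inj₁ jAB)
cornerImage A C = inn (inj₁ jAC)
cornerImage B A = inn (inj₁ jAB)
cornerImage B B = out B
cornerImage B C = inn (inj₁ jBC)
cornerImage C A = inn (inj₁ jAC)
cornerImage C B = inn (inj₁ jBC)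
cornerImage C C = out C

embed : ∀ {k} → Corner → Vertex k → Vertex (suc k)
embed θ (out x) = cornerImage θ x
embed θ (inn i) = inn (inj₂ (θ , i))

data Adj : (k : ℕ) → Vertex k → Vertex k → Set where
  base : ∀ {x y} → x ≢ y → Adj zero (out x) (out y)
  lift : ∀ {k u v} (θ : Corner) → Adj k u v → Adj (suc k) (embed θ u) (embed θ v)

-- Number of vertices, and an (injective) enumeration of the vertices by Fin,
-- so that vertex subsets are the library's Data.Fin.Subset.
innerCount : ℕ → ℕ
innerCount zero    = 0
innerCount (suc k) = 3 + 3 * innerCount k

vertexCount : ℕ → ℕ
vertexCount k = 3 + innerCount k

encCorner : Corner → Fin 3
encCorner A = Fin.zero
  where import Data.Fin as Fin
encCorner B = Fin.suc Fin.zero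
  where import Data.Fin as Fin
encCorner C = Fin.suc (Fin.suc Fin.zero)
  where import Data.Fin as Fin

encJunction : Junction → Fin 3
encJunction jAB = Fin.zero
  where import Data.Fin as Fin
encJunction jAC = Fin.suc Fin.zero
  where import Data.Fin as Fin
encJunction jBC = Fin.suc (Fin.suc Fin.zero)
  where import Data.Fin as Fin

encInner : ∀ k → Inner k → Fin (innerCount k)
encInner (suc k) (inj₁ j)       = join 3 (3 * innerCount k) (inj₁ (encJunction j))
encInner (suc k) (inj₂ (θ , i)) = join 3 (3 * innerCount k) (inj₂ (combine (encCorner θ) (encInner k i)))

enc : ∀ {k} → Vertex k → Fin (vertexCount k)
enc {k} (out x) = join 3 (innerCount k) (inj₁ (encCorner x))
enc {k} (inn i) = join 3 (innerCount k) (inj₂ (encInner k i))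

VSet : ℕ → Set
VSet k = Subset (vertexCount k)

IsIndependent : (k : ℕ) → VSet k → Set
IsIndependent k s = ∀ u v → Adj k u v → enc u ∈ s → enc v ∈ s → ⊥

IsMaximumIndependent : (k : ℕ) → VSet k → Set
IsMaximumIndependent k s =
  IsIndependent k s × (∀ t → IsIndependent k t → ∣ t ∣ ≤ ∣ s ∣)

HasExactly : ∀ {n} → ℕ → (Subset n → Set) → Set
HasExactly {n} m P =
  ∃ λ (L : List (Subset n)) → Unique L × (∀ s → (s ∈ₗ L) ⇔ P s) × length L ≡ m

-- An independent set of the level-k gasket meeting its outmost vertices in the
-- pattern (a, b, c) has at most (3^k − 1)/2 + β(a, b, c) vertices, where β is 0
-- for no outmost vertex, 2 for all three and 1 otherwise.  Induction on k: the
-- three copies share the junction vertices pairwise, so adding the number of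
-- junction vertices to the size of a set gives the sum of the sizes of its
-- three restrictions, and the bound reduces to an inequality between the six
-- outmost and junction bits, checked exhaustively.  The optimal sets, those
-- attaining the bound, are exactly the gluings of optimal sets of the copies
-- along junction bits for which that inequality is an equality.  This gives a
-- recurrence for their numbers N_k(a, b, c) under which the four patterns with
-- one or three outmost vertices are equinumerous from level 1 on, with N_1 = 1
-- and N_{k+1} = 2 N_k³; hence N_{k+1} = 2^((3^k − 1)/2).  Since β ≤ 2 and
-- optimal sets exist for the pattern (1, 1, 1), the maximum independent sets
-- are exactly the optimal sets containing all three outmost vertices.

module Submission where

open import Defs
open import Data.Nat using (ℕ; zero; suc; _+_; _*_; _≤_; _∸_; _^_; NonZero; ≢-nonZero⁻¹; z≤n; s≤s; _≡ᵇ_; _≤ᵇ_)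
open import Data.Nat.Properties
open import Data.Nat.DivMod using (_/_; m*n/n≡m)
open import Data.Nat.Tactic.RingSolver using (solve-∀)
open import Data.Bool using (Bool; true; false; T; if_then_else_; _∧_)
open import Data.Bool.Properties using (T-∧; T-≡)
open import Data.Unit using (⊤; tt)
open import Data.Empty using (⊥-elim)
open import Data.Sum using (inj₁; inj₂)
open import Data.Product using (_×_; _,_; ∃; ∃-syntax; proj₁; proj₂)
open import Data.Fin.Subset using (Subset; _∈_; ∣_∣; ⁅_⁆) renaming (⊥ to ∅)
open import Data.Fin.Subset.Properties using (∉⊥; x∈⁅y⁆⇒x≡y)
open import Data.Vec using (Vec; []; _∷_; _++_; lookup; splitAt; here; there)
open import Data.Vec.Properties using (∷-injectiveʳ; lookup-++ˡ; lookup-++ʳ; []=⇒lookup; lookup⇒[]=; ++-injective)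
open import Data.List using (List; []; _∷_; map; length; cartesianProductWith) renaming (_++_ to _++ₗ_)
open import Data.List.Properties using (length-++; length-map)
open import Data.List.Relation.Unary.Any using () renaming (here to hereₗ)
open import Data.List.Relation.Unary.AllPairs using ([]; _∷_)
open import Data.List.Relation.Unary.All using ([])
open import Data.List.Relation.Unary.Unique.Propositional using (Unique)
open import Data.List.Relation.Unary.Unique.Propositional.Properties using (map⁺; ++⁺; cartesianProductWith⁺)
open import Data.List.Membership.Propositional using () renaming (_∈_ to _∈ₗ_)
open import Data.List.Membership.Propositional.Properties
  using (∈-++⁺ˡ; ∈-++⁺ʳ; ∈-++⁻; ∈-map⁺; ∈-map⁻; ∈-cartesianProductWith⁺; ∈-cartesianProductWith⁻)
open import Function using (_∘_; id)
open import Function.Bundles using (_⇔_; mk⇔; Equivalence)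
open import Relation.Nullary using (¬_)
open import Relation.Binary.PropositionalEquality

open Equivalence using (to; from)

-- Counting by duplicate-free lists

Exactly : ∀ {X : Set} → ℕ → (X → Set) → Set
Exactly {X} m P = ∃ λ (L : List X) → Unique L × (∀ s → (s ∈ₗ L) ⇔ P s) × length L ≡ m

exactly-cong : ∀ {X : Set} {P Q : X → Set} {m n} → (∀ s → P s ⇔ Q s) → m ≡ n → Exactly m P → Exactly n Q
exactly-cong P⇔Q refl (L , unique , ∈⇔P , len) =
  L , unique , (λ s → mk⇔ (to (P⇔Q s) ∘ to (∈⇔P s)) (from (∈⇔P s) ∘ from (P⇔Q s))) , len

exactly-none : ∀ {X : Set} {P : X → Set} → (∀ s → ¬ P s) → Exactly 0 P
exactly-none ¬P = [] , [] , (λ s → mk⇔ (λ ()) (⊥-elim ∘ ¬P s)) , refl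

exactly-[] : ∀ {X : Set} {P : Vec X 0 → Set} → P [] → Exactly 1 P
exactly-[] p = ([] ∷ []) , ([] ∷ []) , (λ { [] → mk⇔ (λ _ → p) (λ _ → hereₗ refl) }) , refl

exactly-nonempty : ∀ {X : Set} {P : X → Set} {m} .{{_ : NonZero m}} → Exactly m P → ∃ P
exactly-nonempty {m = m} ([] , _ , _ , refl) = ⊥-elim (≢-nonZero⁻¹ m refl)
exactly-nonempty (a ∷ _ , _ , ∈⇔P , _) = a , to (∈⇔P a) (hereₗ refl)

sumOverBool : (Bool → ℕ) → ℕ
sumOverBool n = n true + n false

exactly-∷ : ∀ {l} {P : Vec Bool (suc l) → Set} {n : Bool → ℕ} →
  (∀ b → Exactly (n b) (λ v → P (b ∷ v))) → Exactly (sumOverBool n) P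
exactly-∷ {P = P} count with count true | count false
... | L₁ , unique₁ , ∈⇔P₁ , len₁ | L₀ , unique₀ , ∈⇔P₀ , len₀ =
  L ,
  ++⁺ (map⁺ ∷-injectiveʳ unique₁) (map⁺ ∷-injectiveʳ unique₀) disjoint ,
  (λ s → mk⇔ (∈⇒P s) (P⇒∈ s)) ,
  trans (length-++ (map (true ∷_) L₁)) (cong₂ _+_ (trans (length-map _ L₁) len₁) (trans (length-map _ L₀) len₀))
  where
  L = map (true ∷_) L₁ ++ₗ map (false ∷_) L₀
  disjoint : ∀ {v} → ¬ (v ∈ₗ map (true ∷_) L₁ × v ∈ₗ map (false ∷_) L₀)
  disjoint (v∈₁ , v∈₀) with ∈-map⁻ (true ∷_) v∈₁ | ∈-map⁻ (false ∷_) v∈₀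
  ... | _ , _ , refl | _ , _ , ()
  ∈⇒P : ∀ s → s ∈ₗ L → P s
  ∈⇒P s s∈ with ∈-++⁻ (map (true ∷_) L₁) s∈
  ... | inj₁ s∈₁ with ∈-map⁻ (true ∷_) s∈₁
  ...   | v , v∈ , refl = to (∈⇔P₁ v) v∈
  ∈⇒P s s∈ | inj₂ s∈₀ with ∈-map⁻ (false ∷_) s∈₀
  ...   | v , v∈ , refl = to (∈⇔P₀ v) v∈
  P⇒∈ : ∀ s → P s → s ∈ₗ L
  P⇒∈ (true ∷ v) p = ∈-++⁺ˡ (∈-map⁺ (true ∷_) (from (∈⇔P₁ v) p))
  P⇒∈ (false ∷ v) p = ∈-++⁺ʳ (map (true ∷_) L₁) (∈-map⁺ (false ∷_) (from (∈⇔P₀ v) p))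

_⊗_ : ∀ {X : Set} {l l′} → (Vec X l → Set) → (Vec X l′ → Set) → Vec X (l + l′) → Set
_⊗_ {X} {l} {l′} P Q v = ∃ λ (u : Vec X l) → ∃ λ (w : Vec X l′) → v ≡ u ++ w × P u × Q w

length-cartesianProductWith : ∀ {X Y Z : Set} (f : X → Y → Z) xs ys →
  length (cartesianProductWith f xs ys) ≡ length xs * length ys
length-cartesianProductWith f [] ys = refl
length-cartesianProductWith f (x ∷ xs) ys =
  trans (length-++ (map (f x) ys)) (cong₂ _+_ (length-map (f x) ys) (length-cartesianProductWith f xs ys))

exactly-⊗ : ∀ {X : Set} {l l′} {P : Vec X l → Set} {Q : Vec X l′ → Set} {m n} →
  Exactly m P → Exactly n Q → Exactly (m * n) (P ⊗ Q)
exactly-⊗ {P = P} {Q} (L , uniqueL , ∈⇔P , lenL) (M , uniqueM , ∈⇔Q , lenM) =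
  cartesianProductWith _++_ L M ,
  cartesianProductWith⁺ _++_ (λ {u} {u′} → ++-injective u u′) uniqueL uniqueM ,
  (λ s → mk⇔ (∈⇒P⊗Q s) P⊗Q⇒∈) ,
  trans (length-cartesianProductWith _++_ L M) (cong₂ _*_ lenL lenM)
  where
  ∈⇒P⊗Q : ∀ s → s ∈ₗ cartesianProductWith _++_ L M → (P ⊗ Q) s
  ∈⇒P⊗Q s s∈ with ∈-cartesianProductWith⁻ _++_ L M s∈
  ... | u , w , u∈ , w∈ , s≡ = u , w , s≡ , to (∈⇔P u) u∈ , to (∈⇔Q w) w∈
  P⊗Q⇒∈ : ∀ {s} → (P ⊗ Q) s → s ∈ₗ cartesianProductWith _++_ L M
  P⊗Q⇒∈ (u , w , refl , p , q) = ∈-cartesianProductWith⁺ _++_ (from (∈⇔P u) p) (from (∈⇔Q w) q)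

exactly-if : ∀ {X : Set} {P Q : X → Set} {n} (b : Bool) →
  (∀ s → P s ⇔ (T b × Q s)) → Exactly n Q → Exactly (if b then n else 0) P
exactly-if true P⇔Q = exactly-cong (λ s → mk⇔ (λ q → from (P⇔Q s) (tt , q)) (proj₂ ∘ to (P⇔Q s))) refl
exactly-if false P⇔Q _ = exactly-none (λ s → proj₁ ∘ to (P⇔Q s))

exactly-image : ∀ {X Y : Set} {P : X → Set} {Q : Y → Set} {m} (f : X → Y) →
  (∀ {x x′} → f x ≡ f x′ → x ≡ x′) → (∀ y → Q y ⇔ (∃[ x ] P x × f x ≡ y)) →
  Exactly m P → Exactly m Q
exactly-image {Q = Q} f f-injective Q⇔ (L , unique , ∈⇔P , len) =
  map f L , map⁺ f-injective unique , (λ y → mk⇔ (∈⇒Q y) (Q⇒∈ y)) , trans (length-map f L) len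
  where
  ∈⇒Q : ∀ y → y ∈ₗ map f L → Q y
  ∈⇒Q y y∈ with ∈-map⁻ f y∈
  ... | x , x∈ , refl = from (Q⇔ y) (x , to (∈⇔P x) x∈ , refl)
  Q⇒∈ : ∀ y → Q y → y ∈ₗ map f L
  Q⇒∈ y q with to (Q⇔ y) q
  ... | x , p , refl = ∈-map⁺ f (from (∈⇔P x) p)

-- Gluing three copies of the gasket

∣p++q∣≡∣p∣+∣q∣ : ∀ {m n} (p : Subset m) (q : Subset n) → ∣ p ++ q ∣ ≡ ∣ p ∣ + ∣ q ∣
∣p++q∣≡∣p∣+∣q∣ []          q = refl
∣p++q∣≡∣p∣+∣q∣ (true ∷ p)  q = cong suc (∣p++q∣≡∣p∣+∣q∣ p q)
∣p++q∣≡∣p∣+∣q∣ (false ∷ p) q = ∣p++q∣≡∣p∣+∣q∣ p q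

∣abc∷p∣ : ∀ {n} a b c (p : Subset n) → ∣ a ∷ b ∷ c ∷ p ∣ ≡ ∣ a ∷ [] ∣ + (∣ b ∷ [] ∣ + (∣ c ∷ [] ∣ + ∣ p ∣))
∣abc∷p∣ a b c p = trans (∣p++q∣≡∣p∣+∣q∣ (a ∷ []) (b ∷ c ∷ p))
  (cong (∣ a ∷ [] ∣ +_) (trans (∣p++q∣≡∣p∣+∣q∣ (b ∷ []) (c ∷ p)) (cong (∣ b ∷ [] ∣ +_) (∣p++q∣≡∣p∣+∣q∣ (c ∷ []) p))))

independent-∅ : ∀ {k} → IsIndependent k ∅
independent-∅ _ _ _ u∈∅ _ = ∉⊥ u∈∅

enc-out-injective : ∀ {k} x y → enc {k} (out x) ≡ enc {k} (out y) → x ≡ y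
enc-out-injective {k} A A _ = refl
enc-out-injective {k} B B _ = refl
enc-out-injective {k} C C _ = refl
enc-out-injective {k} A B ()
enc-out-injective {k} A C ()
enc-out-injective {k} B A ()
enc-out-injective {k} B C ()
enc-out-injective {k} C A ()
enc-out-injective {k} C B ()

independent₀-⁅corner⁆ : ∀ x → IsIndependent zero ⁅ enc {zero} (out x) ⁆
independent₀-⁅corner⁆ x _ _ (base {u} {v} u≢v) u∈ v∈ =
  u≢v (enc-out-injective {zero} u v (trans (x∈⁅y⁆⇒x≡y _ u∈) (sym (x∈⁅y⁆⇒x≡y _ v∈))))

splitAt³ : ∀ {X : Set} n (w : Vec X (n + (n + (n + 0)))) →
  ∃ λ (u : Vec X n) → ∃ λ (v : Vec X n) → ∃ λ (t : Vec X n) → w ≡ u ++ v ++ t ++ []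
splitAt³ n w with splitAt n w
... | u , w₁ , refl with splitAt n w₁
... | v , w₂ , refl with splitAt n w₂
... | t , [] , refl = u , v , t , refl

module Gluing {k : ℕ} (a b c x y z : Bool) (iA iB iC : Vec Bool (innerCount k)) where

  glued : VSet (suc k)
  glued = a ∷ b ∷ c ∷ x ∷ y ∷ z ∷ iA ++ iB ++ iC ++ []

  copy : Corner → VSet k
  copy A = a ∷ x ∷ y ∷ iA
  copy B = x ∷ b ∷ z ∷ iB
  copy C = y ∷ z ∷ c ∷ iC

  lookup-glued-embed : ∀ θ (u : Vertex k) → lookup glued (enc (embed θ u)) ≡ lookup (copy θ) (enc u)
  lookup-glued-embed A (out A) = refl
  lookup-glued-embed A (out B) = refl
  lookup-glued-embed A (out C) = refl
  lookup-glued-embed B (out A) = refl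
  lookup-glued-embed B (out B) = refl
  lookup-glued-embed B (out C) = refl
  lookup-glued-embed C (out A) = refl
  lookup-glued-embed C (out B) = refl
  lookup-glued-embed C (out C) = refl
  lookup-glued-embed A (inn i) = lookup-++ˡ iA _ (encInner k i)
  lookup-glued-embed B (inn i) = trans (lookup-++ʳ iA _ _) (lookup-++ˡ iB _ (encInner k i))
  lookup-glued-embed C (inn i) =
    trans (lookup-++ʳ iA _ _) (trans (lookup-++ʳ iB _ _) (lookup-++ˡ iC [] (encInner k i)))

  ∈-glued⇔∈-copy : ∀ θ (u : Vertex k) → enc (embed θ u) ∈ glued ⇔ enc u ∈ copy θ
  ∈-glued⇔∈-copy θ u = mk⇔
    (λ u∈ → lookup⇒[]= _ _ (trans (sym (lookup-glued-embed θ u)) ([]=⇒lookup u∈)))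
    (λ u∈ → lookup⇒[]= _ _ (trans (lookup-glued-embed θ u) ([]=⇒lookup u∈)))

  independent-glued⇔ : IsIndependent (suc k) glued ⇔ (∀ θ → IsIndependent k (copy θ))
  independent-glued⇔ = mk⇔
    (λ I θ u v u~v u∈ v∈ → I _ _ (lift θ u~v) (from (∈-glued⇔∈-copy θ u) u∈) (from (∈-glued⇔∈-copy θ v) v∈))
    (λ { I _ _ (lift {u = u} {v} θ u~v) u∈ v∈ →
           I θ u v u~v (to (∈-glued⇔∈-copy θ u) u∈) (to (∈-glued⇔∈-copy θ v) v∈) })

  ∣glued∣+∣junctions∣ : ∣ glued ∣ + ∣ x ∷ y ∷ z ∷ [] ∣ ≡ ∣ copy A ∣ + (∣ copy B ∣ + ∣ copy C ∣)
  ∣glued∣+∣junctions∣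
    rewrite ∣abc∷p∣ a b c (x ∷ y ∷ z ∷ iA ++ iB ++ iC ++ []) | ∣abc∷p∣ x y z (iA ++ iB ++ iC ++ [])
          | ∣p++q∣≡∣p∣+∣q∣ iA (iB ++ iC ++ []) | ∣p++q∣≡∣p∣+∣q∣ iB (iC ++ []) | ∣p++q∣≡∣p∣+∣q∣ iC []
          | ∣abc∷p∣ x y z [] | ∣abc∷p∣ a x y iA | ∣abc∷p∣ x b z iB | ∣abc∷p∣ y z c iC
    = rearrange (∣ a ∷ [] ∣) (∣ b ∷ [] ∣) (∣ c ∷ [] ∣) (∣ x ∷ [] ∣) (∣ y ∷ [] ∣) (∣ z ∷ [] ∣) (∣ iA ∣) (∣ iB ∣) (∣ iC ∣)
    where
    rearrange : ∀ a b c x y z iA iB iC →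
      (a + (b + (c + (x + (y + (z + (iA + (iB + (iC + 0))))))))) + (x + (y + (z + 0)))
        ≡ (a + (x + (y + iA))) + ((x + (b + (z + iB))) + (y + (z + (c + iC))))
    rearrange = solve-∀

-- The size bound

every : (Bool → Bool) → Bool
every f = f true ∧ f false

every-sound : ∀ f → every f ≡ true → ∀ b → f b ≡ true
every-sound f h true  = to T-≡ (proj₁ (to T-∧ (from T-≡ h)))
every-sound f h false = to T-≡ (proj₂ (to T-∧ (from T-≡ h)))

every⁶-sound : (f : Bool → Bool → Bool → Bool → Bool → Bool → Bool) →
  every (λ a → every λ b → every λ c → every λ x → every λ y → every λ z → f a b c x y z) ≡ true →
  ∀ a b c x y z → f a b c x y z ≡ true
every⁶-sound f h a b c x y z =
  every-sound (f a b c x y) (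
  every-sound (λ y → every (f a b c x y)) (
  every-sound (λ x → every λ y → every (f a b c x y)) (
  every-sound (λ c → every λ x → every λ y → every (f a b c x y)) (
  every-sound (λ b → every λ c → every λ x → every λ y → every (f a b c x y)) (
  every-sound (λ a → every λ b → every λ c → every λ x → every λ y → every (f a b c x y)) h
    a) b) c) x) y) z

bonus : Bool → Bool → Bool → ℕ
bonus false false false = 0
bonus true  true  true  = 2
bonus _     _     _     = 1

copiesBonus : (a b c x y z : Bool) → ℕ
copiesBonus a b c x y z = bonus a x y + (bonus x b z + bonus y z c)

copiesBonus≤ : ∀ a b c x y z → copiesBonus a b c x y z ≤ suc (bonus a b c + ∣ x ∷ y ∷ z ∷ [] ∣)
copiesBonus≤ a b c x y z = ≤ᵇ⇒≤ _ _ (from T-≡ (every⁶-sound check refl a b c x y z))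
  where
  -- `refl` in the proof evaluates `check` on all 64 assignments
  check : (a b c x y z : Bool) → Bool
  check a b c x y z = copiesBonus a b c x y z ≤ᵇ suc (bonus a b c + ∣ x ∷ y ∷ z ∷ [] ∣)

tight : (a b c x y z : Bool) → Bool
tight a b c x y z = copiesBonus a b c x y z ≡ᵇ suc (bonus a b c + ∣ x ∷ y ∷ z ∷ [] ∣)

+-≤-tight : ∀ {m n o p} → m ≤ n → o ≤ p → m + o ≡ n + p → m ≡ n × o ≡ p
+-≤-tight {m} {n} {o} {p} m≤n o≤p eq = m≡n , +-cancelˡ-≡ n o p (trans (cong (_+ o) (sym m≡n)) eq)
  where
  m≡n : m ≡ n
  m≡n = ≤-antisym m≤n (+-cancelʳ-≤ p n m (≤-trans (≤-reflexive (sym eq)) (+-monoʳ-≤ m o≤p)))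

squeeze : ∀ {m n o} → m ≤ n → n ≤ o → m ≡ o → m ≡ n × n ≡ o
squeeze m≤n n≤o refl = ≤-antisym m≤n n≤o , ≤-antisym n≤o m≤n

αInner : ℕ → ℕ
αInner zero    = 0
αInner (suc k) = suc (3 * αInner k)

SizeBound : ℕ → Set
SizeBound k = ∀ a b c (i : Vec Bool (innerCount k)) →
  IsIndependent k (a ∷ b ∷ c ∷ i) → ∣ a ∷ b ∷ c ∷ i ∣ ≤ αInner k + bonus a b c

Optimal : ∀ k → Bool → Bool → Bool → Vec Bool (innerCount k) → Set
Optimal k a b c i = IsIndependent k (a ∷ b ∷ c ∷ i) × ∣ a ∷ b ∷ c ∷ i ∣ ≡ αInner k + bonus a b c

module GluedBound {k : ℕ} (bound : SizeBound k) (a b c x y z : Bool) (iA iB iC : Vec Bool (innerCount k)) where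

  open Gluing {k} a b c x y z iA iB iC

  copiesSize copiesBound gluedBound : ℕ
  copiesSize  = ∣ copy A ∣ + (∣ copy B ∣ + ∣ copy C ∣)
  copiesBound = (αInner k + bonus a x y) + ((αInner k + bonus x b z) + (αInner k + bonus y z c))
  gluedBound  = (αInner (suc k) + bonus a b c) + ∣ x ∷ y ∷ z ∷ [] ∣

  copiesSize≤copiesBound : (∀ θ → IsIndependent k (copy θ)) → copiesSize ≤ copiesBound
  copiesSize≤copiesBound I =
    +-mono-≤ (bound a x y iA (I A)) (+-mono-≤ (bound x b z iB (I B)) (bound y z c iC (I C)))

  private
    rearrangeCopies : ∀ m o₁ o₂ o₃ → (m + o₁) + ((m + o₂) + (m + o₃)) ≡ 3 * m + (o₁ + (o₂ + o₃))
    rearrangeCopies = solve-∀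
    rearrangeGlued : ∀ m p j → (suc (3 * m) + p) + j ≡ 3 * m + suc (p + j)
    rearrangeGlued = solve-∀

    copiesBound≡ : copiesBound ≡ 3 * αInner k + copiesBonus a b c x y z
    copiesBound≡ = rearrangeCopies (αInner k) (bonus a x y) (bonus x b z) (bonus y z c)

    gluedBound≡ : gluedBound ≡ 3 * αInner k + suc (bonus a b c + ∣ x ∷ y ∷ z ∷ [] ∣)
    gluedBound≡ = rearrangeGlued (αInner k) (bonus a b c) ∣ x ∷ y ∷ z ∷ [] ∣

  copiesBound≤gluedBound : copiesBound ≤ gluedBound
  copiesBound≤gluedBound = subst₂ _≤_ (sym copiesBound≡) (sym gluedBound≡)
    (+-monoʳ-≤ (3 * αInner k) (copiesBonus≤ a b c x y z))

  copiesBound≡gluedBound⇔tight : copiesBound ≡ gluedBound ⇔ T (tight a b c x y z)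
  copiesBound≡gluedBound⇔tight = mk⇔
    (λ eq → ≡⇒≡ᵇ _ _ (+-cancelˡ-≡ (3 * αInner k) _ _ (trans (sym copiesBound≡) (trans eq gluedBound≡))))
    (λ t → trans copiesBound≡ (trans (cong (3 * αInner k +_) (≡ᵇ⇒≡ _ _ t)) (sym gluedBound≡)))

  glued≤ : IsIndependent (suc k) glued → ∣ glued ∣ ≤ αInner (suc k) + bonus a b c
  glued≤ I = +-cancelʳ-≤ ∣ x ∷ y ∷ z ∷ [] ∣ _ _ (begin
    ∣ glued ∣ + ∣ x ∷ y ∷ z ∷ [] ∣ ≡⟨ ∣glued∣+∣junctions∣ ⟩
    copiesSize                     ≤⟨ copiesSize≤copiesBound (to independent-glued⇔ I) ⟩
    copiesBound                    ≤⟨ copiesBound≤gluedBound ⟩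
    gluedBound                     ∎)
    where open ≤-Reasoning

  optimal-glued⇔ : Optimal (suc k) a b c (x ∷ y ∷ z ∷ iA ++ iB ++ iC ++ []) ⇔
    (T (tight a b c x y z) × Optimal k a x y iA × Optimal k x b z iB × Optimal k y z c iC)
  optimal-glued⇔ = mk⇔ split join
    where
    split : Optimal (suc k) a b c (x ∷ y ∷ z ∷ iA ++ iB ++ iC ++ []) →
      T (tight a b c x y z) × Optimal k a x y iA × Optimal k x b z iB × Optimal k y z c iC
    split (I , size≡) =
      let I′ = to independent-glued⇔ I
          boundA = bound a x y iA (I′ A)
          boundB = bound x b z iB (I′ B)
          boundC = bound y z c iC (I′ C)
          copiesSize≡gluedBound = trans (sym ∣glued∣+∣junctions∣) (cong (_+ ∣ x ∷ y ∷ z ∷ [] ∣) size≡)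
          (copiesSize≡copiesBound , copiesBound≡gluedBound) =
            squeeze (+-mono-≤ boundA (+-mono-≤ boundB boundC)) copiesBound≤gluedBound copiesSize≡gluedBound
          (eA , eBC) = +-≤-tight boundA (+-mono-≤ boundB boundC) copiesSize≡copiesBound
          (eB , eC) = +-≤-tight boundB boundC eBC
      in to copiesBound≡gluedBound⇔tight copiesBound≡gluedBound , (I′ A , eA) , (I′ B , eB) , (I′ C , eC)
    join : T (tight a b c x y z) × Optimal k a x y iA × Optimal k x b z iB × Optimal k y z c iC →
      Optimal (suc k) a b c (x ∷ y ∷ z ∷ iA ++ iB ++ iC ++ [])
    join (t , (IA , eA) , (IB , eB) , (IC , eC)) =
      from independent-glued⇔ (λ { A → IA ; B → IB ; C → IC }) ,
      +-cancelʳ-≡ ∣ x ∷ y ∷ z ∷ [] ∣ _ _ (begin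
        ∣ glued ∣ + ∣ x ∷ y ∷ z ∷ [] ∣ ≡⟨ ∣glued∣+∣junctions∣ ⟩
        copiesSize                     ≡⟨ cong₂ _+_ eA (cong₂ _+_ eB eC) ⟩
        copiesBound                    ≡⟨ from copiesBound≡gluedBound⇔tight t ⟩
        gluedBound                     ∎)
      where open ≡-Reasoning

sizeBound : ∀ k → SizeBound k
sizeBound zero true  true  _     [] I = ⊥-elim (I (out A) (out B) (base λ ()) here (there here))
sizeBound zero true  false true  [] I = ⊥-elim (I (out A) (out C) (base λ ()) here (there (there here)))
sizeBound zero false true  true  [] I = ⊥-elim (I (out B) (out C) (base λ ()) (there here) (there (there here)))
sizeBound zero true  false false [] _ = ≤-refl
sizeBound zero false true  false [] _ = ≤-refl
sizeBound zero false false true  [] _ = ≤-refl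
sizeBound zero false false false [] _ = ≤-refl
sizeBound (suc k) a b c (x ∷ y ∷ z ∷ w) I with splitAt³ (innerCount k) w
... | iA , iB , iC , refl = GluedBound.glued≤ (sizeBound k) a b c x y z iA iB iC I

-- Counting optimal sets

optimalCount : ℕ → Bool → Bool → Bool → ℕ
optimalCount zero true  true  _     = 0
optimalCount zero true  false true  = 0
optimalCount zero false true  true  = 0
optimalCount zero _     _     _     = 1
optimalCount (suc k) a b c =
  sumOverBool λ x → sumOverBool λ y → sumOverBool λ z →
    if tight a b c x y z then optimalCount k a x y * (optimalCount k x b z * optimalCount k y z c) else 0

module _ {k : ℕ} (count : ∀ a b c → Exactly (optimalCount k a b c) (Optimal k a b c)) (a b c x y z : Bool) where

  private
    -- the factor `λ _ → ⊤` absorbs the `+ 0` of `3 * n = n + (n + (n + 0))`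
    OptimalCopies : Vec Bool (innerCount k + (innerCount k + (innerCount k + 0))) → Set
    OptimalCopies = Optimal k a x y ⊗ (Optimal k x b z ⊗ (Optimal k y z c ⊗ λ _ → ⊤))

    optimal⇔optimalCopies : ∀ w → Optimal (suc k) a b c (x ∷ y ∷ z ∷ w) ⇔ (T (tight a b c x y z) × OptimalCopies w)
    optimal⇔optimalCopies w = mk⇔ (split w) join
      where
      split : ∀ w → Optimal (suc k) a b c (x ∷ y ∷ z ∷ w) → T (tight a b c x y z) × OptimalCopies w
      split w o with splitAt³ (innerCount k) w
      ... | iA , iB , iC , refl =
        let (t , oA , oB , oC) = to (GluedBound.optimal-glued⇔ (sizeBound k) a b c x y z iA iB iC) o
        in t , (iA , _ , refl , oA , (iB , _ , refl , oB , (iC , [] , refl , oC , tt)))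
      join : T (tight a b c x y z) × OptimalCopies w → Optimal (suc k) a b c (x ∷ y ∷ z ∷ w)
      join (t , (iA , _ , refl , oA , (iB , _ , refl , oB , (iC , [] , refl , oC , _)))) =
        from (GluedBound.optimal-glued⇔ (sizeBound k) a b c x y z iA iB iC) (t , oA , oB , oC)

  optimalSets-junction : Exactly (if tight a b c x y z then optimalCount k a x y * (optimalCount k x b z * optimalCount k y z c) else 0)
    (λ w → Optimal (suc k) a b c (x ∷ y ∷ z ∷ w))
  optimalSets-junction = exactly-if (tight a b c x y z) optimal⇔optimalCopies
    (exactly-cong (λ _ → mk⇔ id id) (cong (optimalCount k a x y *_) (cong (optimalCount k x b z *_) (*-identityʳ _)))
      (exactly-⊗ (count a x y) (exactly-⊗ (count x b z) (exactly-⊗ (count y z c) (exactly-[] tt)))))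

optimalSets : ∀ k a b c → Exactly (optimalCount k a b c) (Optimal k a b c)
optimalSets zero true  true  true  = exactly-none λ { [] (_ , ()) }
optimalSets zero true  true  false = exactly-none λ { [] (_ , ()) }
optimalSets zero true  false true  = exactly-none λ { [] (_ , ()) }
optimalSets zero false true  true  = exactly-none λ { [] (_ , ()) }
optimalSets zero true  false false = exactly-[] (independent₀-⁅corner⁆ A , refl)
optimalSets zero false true  false = exactly-[] (independent₀-⁅corner⁆ B , refl)
optimalSets zero false false true  = exactly-[] (independent₀-⁅corner⁆ C , refl)
optimalSets zero false false false = exactly-[] (independent-∅ , refl)
optimalSets (suc k) a b c =
  exactly-∷ λ x → exactly-∷ λ y → exactly-∷ λ z → optimalSets-junction (optimalSets k) a b c x y z

optimalCount-suc : ∀ k →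
  let t = optimalCount k true true true
      p = optimalCount k true false false
      q = optimalCount k false true false
      r = optimalCount k false false true
  in optimalCount (suc k) true  true  true  ≡ t * t * t + p * q * r ×
     optimalCount (suc k) true  false false ≡ t * p * p + p * q * r ×
     optimalCount (suc k) false true  false ≡ t * q * q + p * q * r ×
     optimalCount (suc k) false false true  ≡ t * r * r + p * q * r
optimalCount-suc k = ttt (N true true true) (N true false false) (N false true false) (N false false true)
                   , tff (N true true true) (N true false false) (N false true false) (N false false true)
                   , ftf (N true true true) (N true false false) (N false true false) (N false false true)
                   , fft (N true true true) (N true false false) (N false true false) (N false false true)
  where
  -- the left-hand sides are the normal forms of `optimalCount (suc k)` at the four patterns
  N = optimalCount k
  ttt : ∀ t p q r → t * (t * t) + 0 + 0 + p * (q * r) ≡ t * t * t + p * q * r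
  ttt = solve-∀
  tff : ∀ t p q r → t * (p * p) + 0 + (p * (r * q) + 0) ≡ t * p * p + p * q * r
  tff = solve-∀
  ftf : ∀ t p q r → q * (t * q) + 0 + (r * (q * p) + 0) ≡ t * q * q + p * q * r
  ftf = solve-∀
  fft : ∀ t p q r → q * (p * r) + (r * (r * t) + 0 + 0) ≡ t * r * r + p * q * r
  fft = solve-∀

Uniform : ℕ → ℕ → Set
Uniform k n = optimalCount k true  true  true  ≡ n × optimalCount k true  false false ≡ n ×
              optimalCount k false true  false ≡ n × optimalCount k false false true  ≡ n

uniform-suc : ∀ {k n} → Uniform k n → Uniform (suc k) (2 * (n * n * n))
uniform-suc {k} {n} (eT , eP , eQ , eR) =
  let (sT , sP , sQ , sR) = optimalCount-suc k
  in trans sT (at-uniform eT eT) , trans sP (at-uniform eT eP) , trans sQ (at-uniform eT eQ) , trans sR (at-uniform eT eR)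
  where
  at-uniform : ∀ {t x} → t ≡ n → x ≡ n →
    t * x * x + optimalCount k true false false * optimalCount k false true false * optimalCount k false false true
      ≡ 2 * (n * n * n)
  at-uniform refl refl rewrite eP | eQ | eR = double n
    where
    double : ∀ m → m * m * m + m * m * m ≡ 2 * (m * m * m)
    double = solve-∀

uniform-pow : ∀ k → Uniform (suc k) (2 ^ αInner k)
uniform-pow zero    = refl , refl , refl , refl
uniform-pow (suc k) = subst (Uniform (suc (suc k))) (2*[2^m]³≡2^[1+3m] (αInner k)) (uniform-suc {suc k} (uniform-pow k))
  where
  2*[2^m]³≡2^[1+3m] : ∀ m → 2 * (2 ^ m * 2 ^ m * 2 ^ m) ≡ 2 ^ suc (3 * m)
  2*[2^m]³≡2^[1+3m] m = cong (2 *_) (begin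
    2 ^ m * 2 ^ m * 2 ^ m       ≡⟨ cube (2 ^ m) ⟩
    (2 ^ m) ^ 3                 ≡⟨ ^-*-assoc 2 m 3 ⟩
    2 ^ (m * 3)                 ≡⟨ cong (2 ^_) (*-comm m 3) ⟩
    2 ^ (3 * m)                 ∎)
    where
    open ≡-Reasoning
    cube : ∀ x → x * x * x ≡ x * (x * (x * 1))
    cube = solve-∀

3^k≡1+2αInner : ∀ k → 3 ^ k ≡ suc (αInner k * 2)
3^k≡1+2αInner zero    = refl
3^k≡1+2αInner (suc k) = trans (cong (3 *_) (3^k≡1+2αInner k)) (triple (αInner k))
  where
  triple : ∀ m → 3 * suc (m * 2) ≡ suc (suc (3 * m) * 2)
  triple = solve-∀

[3^k∸1]/2≡αInner : ∀ k → (3 ^ k ∸ 1) / 2 ≡ αInner k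
[3^k∸1]/2≡αInner k = trans (cong (λ t → (t ∸ 1) / 2) (3^k≡1+2αInner k)) (m*n/n≡m (αInner k) 2)

-- Maximum independent sets

bonus≤2 : ∀ a b c → bonus a b c ≤ 2
bonus≤2 true  true  true  = ≤-refl
bonus≤2 true  true  false = s≤s z≤n
bonus≤2 true  false true  = s≤s z≤n
bonus≤2 true  false false = s≤s z≤n
bonus≤2 false true  true  = s≤s z≤n
bonus≤2 false true  false = s≤s z≤n
bonus≤2 false false true  = s≤s z≤n
bonus≤2 false false false = z≤n

2≤bonus⇒all : ∀ a b c → 2 ≤ bonus a b c → a ≡ true × b ≡ true × c ≡ true
2≤bonus⇒all true  true  true  _           = refl , refl , refl
2≤bonus⇒all true  true  false (s≤s ())
2≤bonus⇒all true  false true  (s≤s ())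
2≤bonus⇒all true  false false (s≤s ())
2≤bonus⇒all false true  true  (s≤s ())
2≤bonus⇒all false true  false (s≤s ())
2≤bonus⇒all false false true  (s≤s ())
2≤bonus⇒all false false false ()

maximum⇔optimal : ∀ {k} → ∃ (Optimal k true true true) → ∀ s →
  IsMaximumIndependent k s ⇔ (∃[ i ] Optimal k true true true i × true ∷ true ∷ true ∷ i ≡ s)
maximum⇔optimal {k} (w , Iw , ∣w∣≡) s = mk⇔ (maximum⇒optimal s) optimal⇒maximum
  where
  α+2≤ : ∀ {s} → IsMaximumIndependent k s → αInner k + 2 ≤ ∣ s ∣
  α+2≤ {s} (_ , maximal) = subst (_≤ ∣ s ∣) ∣w∣≡ (maximal _ Iw)
  maximum⇒optimal : ∀ s → IsMaximumIndependent k s → ∃[ i ] Optimal k true true true i × true ∷ true ∷ true ∷ i ≡ s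
  maximum⇒optimal (a ∷ b ∷ c ∷ i) M@(I , _)
    with 2≤bonus⇒all a b c (+-cancelˡ-≤ (αInner k) 2 (bonus a b c) (≤-trans (α+2≤ M) (sizeBound k a b c i I)))
  ... | refl , refl , refl = i , (I , ≤-antisym (sizeBound k true true true i I) (α+2≤ M)) , refl
  optimal⇒maximum : (∃[ i ] Optimal k true true true i × true ∷ true ∷ true ∷ i ≡ s) → IsMaximumIndependent k s
  optimal⇒maximum (i , (I , ∣s∣≡) , refl) = I , λ { (a ∷ b ∷ c ∷ t) It →
    ≤-trans (sizeBound k a b c t It) (subst (αInner k + bonus a b c ≤_) (sym ∣s∣≡) (+-monoʳ-≤ (αInner k) (bonus≤2 a b c))) }

mainTheorem7 : ∀ (n : ℕ) → 2 ≤ n →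
    HasExactly (2 ^ ((3 ^ (n ∸ 2) ∸ 1) / 2)) (IsMaximumIndependent (n ∸ 1))
mainTheorem7 (suc (suc k)) _ =
  exactly-image (λ i → true ∷ true ∷ true ∷ i) (λ { refl → refl }) (maximum⇔optimal witness) optimalSets′
  where
  optimalSets′ : Exactly (2 ^ ((3 ^ k ∸ 1) / 2)) (Optimal (suc k) true true true)
  optimalSets′ = exactly-cong (λ _ → mk⇔ id id)
    (trans (proj₁ (uniform-pow k)) (cong (2 ^_) (sym ([3^k∸1]/2≡αInner k))))
    (optimalSets (suc k) true true true)
  witness : ∃ (Optimal (suc k) true true true)
  witness = exactly-nonempty {{m^n≢0 2 ((3 ^ k ∸ 1) / 2)}} optimalSets′
mainTheorem7 (suc zero) (s≤s ())
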